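{- For every positive integer $n$, the set $\mathscr{C}_{F_{k}}(n)$ of compositions of $n$ in which each part equal to $k$ comes in $F_{k}$ colors is in one-to-one correspondence with the set of words of length $n-1$ over the alphabet $\{0,1,2\}$ in which every maximal run of consecutive $0$s has even length. These sets are enumerated by the Pell numbers $1,2,5,12,29,70,\dots$, i.e. their common cardinality $P_n$ satisfies $P_1=1$, $P_2=2$, $P_n=2P_{n-1}+P_{n-2}$ for $n\ge3$.
   Context: $F_0=0$, $F_1=1$, $F_n=F_{n-1}+F_{n-2}$ for $n\ge2$ are the Fibonacci numbers. A composition of $n$ is an ordered tuple of positive integers (parts) summing to $n$. Given a sequence $(w_k)_{k\ge1}$ of nonnegative integers, a $w$-colored composition of $n$ is a composition $(j_1,\dots,j_m)$ of $n$ together with a choice, for each $i$, of one of $w_{j_i}$ colors for the part $j_i$; $\mathscr{C}_{w_k}(n)$ denotes the set of such colored compositions. Here $w_k=F_k$. -}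

module Defs where

open import Data.Nat using (ℕ; zero; suc; _+_; _*_; _∸_; _≤_; _<_)
open import Data.Nat.Divisibility using (_∣_)
open import Data.Fin using (Fin)
open import Data.Vec using (Vec; []; _∷_)
open import Data.Maybe using (Maybe; just; nothing)
open import Data.Product using (Σ; ∃; _×_)
open import Relation.Binary.PropositionalEquality using (_≡_; _≢_)
open import Function.Definitions using (Injective)

fib : ℕ → ℕ
fib zero = 0
fib (suc zero) = 1
fib (suc (suc n)) = fib (suc n) + fib n

pell : ℕ → ℕ
pell zero = 0
pell (suc zero) = 1
pell (suc (suc n)) = 2 * pell (suc n) + pell n

-- F-colored compositions of n: ordered lists of positive parts summing to n,
-- each part j carrying one of F j colors (an element of Fin (fib j)).
-- 'part k c rest' prepends the part (suc k) (so it is positive) with color c.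
data CComp : ℕ → Set where
  []  : CComp 0
  part : ∀ {m} (k : ℕ) → (color : Fin (fib (suc k))) → CComp m → CComp (suc k + m)

at : ∀ {A : Set} {m} → Vec A m → ℕ → Maybe A
at [] _ = nothing
at (x ∷ xs) zero = just x
at (x ∷ xs) (suc p) = at xs p

zero₃ : Fin 3
zero₃ = Fin.zero
  where import Data.Fin as Fin

MaximalZeroRun : ∀ {m} → Vec (Fin 3) m → ℕ → ℕ → Set
MaximalZeroRun w i len =
    (1 ≤ len)
  × (∀ p → i ≤ p → p < i + len → at w p ≡ just zero₃)
  × (∀ k → suc k ≡ i → at w k ≢ just zero₃)
  × (at w (i + len) ≢ just zero₃)

EvenZeroRuns : ∀ {m} → Vec (Fin 3) m → Set
EvenZeroRuns w = ∀ i len → MaximalZeroRun w i len → 2 ∣ len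

BijOntoEvenZeroRunWords : ∀ {A : Set} (m : ℕ) → (A → Vec (Fin 3) m) → Set
BijOntoEvenZeroRunWords {A} m f =
    Injective _≡_ _≡_ f
  × (∀ a → EvenZeroRuns (f a))
  × (∀ w → EvenZeroRuns w → Σ A (λ a → f a ≡ w))

{-# OPTIONS --safe #-}
-- Deleting the first part of an F-coloured composition of n+1 if it has size 1, or else
-- one unit (resp. two units) of it when its size is k+2 and its colour lies among the first
-- F(k+1) (resp. last F(k)) of its F(k+2) = F(k+1) + F(k) colours, leaves a coloured
-- composition of n (resp. n−1). So compositions of n+1, the numbers below P(n+1), and
-- tilings of length n by the tiles 1, 2 and 00 all satisfy X(n+1) ≅ X(n) ⊎ X(n) ⊎ X(n−1)
-- with a single object at 0, hence are isomorphic; and read as words, the tilings are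
-- exactly the words whose maximal runs of 0s have even length.
module Submission where

open import Defs
open import Data.Nat using (ℕ; zero; suc; _+_; _∸_; _≤_; z≤n; s≤s)
open import Data.Nat.Properties using (+-identityʳ; ≤-refl; m<m+n)
open import Data.Nat.Divisibility using (∣1⇒≡1; ∣-refl; ∣m∣n⇒∣m+n; ∣m+n∣m⇒∣n)
open import Data.Fin using (Fin; splitAt; join; _↑ˡ_; _↑ʳ_) renaming (zero to fzero; suc to fsuc)
open import Data.Fin.Properties using (+↔⊎; 0↔⊥; 1↔⊤; splitAt-↑ˡ; splitAt-↑ʳ; join-splitAt)
open import Data.Vec using (Vec; []; _∷_)
open import Data.Vec.Properties using (∷-injectiveʳ)
open import Data.Maybe using (just)
open import Data.Product using (Σ; _×_; _,_)
open import Data.Sum using (_⊎_; inj₁; inj₂)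
open import Data.Empty using (⊥; ⊥-elim)
open import Data.Unit using (⊤; tt)
open import Data.Sum.Function.Propositional using (_⊎-↔_)
open import Function using (_∘_)
open import Function.Bundles using (_↔_; Inverse; Injection; mk↔ₛ′)
open import Function.Properties.Inverse using (↔-refl; ↔-sym; ↔-trans; ↔⇒↣)
open import Relation.Nullary using (¬_)
open import Relation.Binary.PropositionalEquality using (_≡_; _≢_; refl; trans; cong; subst)

Prev : (ℕ → Set) → ℕ → Set
Prev X zero    = ⊥
Prev X (suc n) = X n

PellRecurrence : (ℕ → Set) → Set
PellRecurrence X = ∀ n → X (suc n) ↔ ((X n ⊎ X n) ⊎ Prev X n)

data Tiling : ℕ → Set where
  []   : Tiling 0
  1∷_  : ∀ {n} → Tiling n → Tiling (suc n)
  2∷_  : ∀ {n} → Tiling n → Tiling (suc n)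
  00∷_ : ∀ {n} → Tiling n → Tiling (suc (suc n))

Tiling0↔⊤ : Tiling 0 ↔ ⊤
Tiling0↔⊤ = mk↔ₛ′ (λ _ → tt) (λ _ → []) (λ _ → refl) (λ { [] → refl })

Tiling-pellRecurrence : PellRecurrence Tiling
Tiling-pellRecurrence n = mk↔ₛ′ to (from n) (to∘from n) from∘to
  where
  to : ∀ {n} → Tiling (suc n) → (Tiling n ⊎ Tiling n) ⊎ Prev Tiling n
  to (1∷ t)  = inj₁ (inj₁ t)
  to (2∷ t)  = inj₁ (inj₂ t)
  to (00∷ t) = inj₂ t

  from : ∀ n → (Tiling n ⊎ Tiling n) ⊎ Prev Tiling n → Tiling (suc n)
  from n       (inj₁ (inj₁ t)) = 1∷ t
  from n       (inj₁ (inj₂ t)) = 2∷ t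
  from (suc n) (inj₂ t)        = 00∷ t

  to∘from : ∀ n s → to (from n s) ≡ s
  to∘from n       (inj₁ (inj₁ t)) = refl
  to∘from n       (inj₁ (inj₂ t)) = refl
  to∘from (suc n) (inj₂ t)        = refl

  from∘to : ∀ {n} t → from n (to t) ≡ t
  from∘to (1∷ t)  = refl
  from∘to (2∷ t)  = refl
  from∘to (00∷ t) = refl

pellRecurrence⇒↔Tiling : ∀ {X} → X 0 ↔ ⊤ → PellRecurrence X → ∀ n → X n ↔ Tiling n
pellRecurrence⇒↔Tiling {X} base step = iso
  where
  iso  : ∀ n → X n ↔ Tiling n
  prev : ∀ n → Prev X n ↔ Prev Tiling n
  iso zero    = ↔-trans base (↔-sym Tiling0↔⊤)
  iso (suc n) = ↔-trans (step n)
                  (↔-trans ((iso n ⊎-↔ iso n) ⊎-↔ prev n) (↔-sym (Tiling-pellRecurrence n)))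
  prev zero    = ↔-refl
  prev (suc n) = iso n

Fin-+-identityʳ : ∀ m → Fin (m + 0) ↔ Fin m
Fin-+-identityʳ m rewrite +-identityʳ m = ↔-refl

Fin-pell↔Prev : ∀ n → Fin (pell n) ↔ Prev (Fin ∘ pell ∘ suc) n
Fin-pell↔Prev zero    = 0↔⊥
Fin-pell↔Prev (suc n) = ↔-refl

Fin-pell-pellRecurrence : PellRecurrence (Fin ∘ pell ∘ suc)
Fin-pell-pellRecurrence n =
  ↔-trans +↔⊎ ((↔-trans +↔⊎ (↔-refl ⊎-↔ Fin-+-identityʳ (pell (suc n)))) ⊎-↔ Fin-pell↔Prev n)

Fin-pell↔Tiling : ∀ n → Fin (pell (suc n)) ↔ Tiling n
Fin-pell↔Tiling = pellRecurrence⇒↔Tiling 1↔⊤ Fin-pell-pellRecurrence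

CComp1↔⊤ : CComp 1 ↔ ⊤
CComp1↔⊤ = mk↔ₛ′ (λ _ → tt) (λ _ → part 0 fzero []) (λ _ → refl) (λ c → unique c refl)
  where
  unique : ∀ {n} (c : CComp (suc n)) (n≡0 : n ≡ 0) → part 0 fzero [] ≡ subst (CComp ∘ suc) n≡0 c
  unique (part zero fzero []) refl = refl

CComp-pellRecurrence : PellRecurrence (CComp ∘ suc)
CComp-pellRecurrence n = mk↔ₛ′ to (from n) (to∘from n) from∘to
  where
  shrink : ∀ {m} k → Fin (fib (suc k)) ⊎ Fin (fib k) → CComp m
         → (CComp (suc (k + m)) ⊎ CComp (suc (k + m))) ⊎ Prev (CComp ∘ suc) (k + m)
  shrink k       (inj₁ c) rest = inj₁ (inj₂ (part k c rest))
  shrink (suc k) (inj₂ c) rest = inj₂ (part k c rest)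

  -- The index suc k + m of part does not unify with suc (suc n), so we match
  -- at a general index n′ and recover n from an equation (likewise in CComp1↔⊤).
  unpart : ∀ {n n′} → CComp (suc n′) → n′ ≡ suc n
         → (CComp (suc n) ⊎ CComp (suc n)) ⊎ Prev (CComp ∘ suc) n
  unpart (part zero    _ rest) refl = inj₁ (inj₁ rest)
  unpart (part (suc k) c rest) refl = shrink k (splitAt (fib (suc k)) c) rest

  to : ∀ {n} → CComp (suc (suc n)) → (CComp (suc n) ⊎ CComp (suc n)) ⊎ Prev (CComp ∘ suc) n
  to c = unpart c refl

  grow : ∀ {n} → CComp (suc n) → CComp (suc (suc n))
  grow (part k c rest) = part (suc k) (c ↑ˡ fib k) rest

  grow₂ : ∀ {n} → CComp (suc n) → CComp (suc (suc (suc n)))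
  grow₂ (part k c rest) = part (suc (suc k)) (fib (suc (suc k)) ↑ʳ c) rest

  from : ∀ n → (CComp (suc n) ⊎ CComp (suc n)) ⊎ Prev (CComp ∘ suc) n → CComp (suc (suc n))
  from n       (inj₁ (inj₁ c)) = part 0 fzero c
  from n       (inj₁ (inj₂ c)) = grow c
  from (suc n) (inj₂ c)        = grow₂ c

  to∘from : ∀ n s → to (from n s) ≡ s
  to∘from n       (inj₁ (inj₁ c))               = refl
  to∘from n       (inj₁ (inj₂ (part k c rest)))
    rewrite splitAt-↑ˡ (fib (suc k)) c (fib k) = refl
  to∘from (suc n) (inj₂ (part k c rest))
    rewrite splitAt-↑ʳ (fib (suc (suc k))) (fib (suc k)) c = refl

  from∘shrink : ∀ {m} k s (rest : CComp m)
              → from (k + m) (shrink k s rest) ≡ part (suc k) (join (fib (suc k)) (fib k) s) rest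
  from∘shrink k       (inj₁ c) rest = refl
  from∘shrink (suc k) (inj₂ c) rest = refl

  from∘unpart : ∀ {n n′} (c : CComp (suc n′)) (eq : n′ ≡ suc n)
              → from n (unpart c eq) ≡ subst (CComp ∘ suc) eq c
  from∘unpart (part zero    fzero rest) refl = refl
  from∘unpart (part (suc k) c     rest) refl =
    trans (from∘shrink k (splitAt (fib (suc k)) c) rest)
          (cong (λ c′ → part (suc k) c′ rest) (join-splitAt (fib (suc k)) (fib k) c))

  from∘to : ∀ {n} c → from n (to c) ≡ c
  from∘to c = from∘unpart c refl

CComp↔Tiling : ∀ n → CComp (suc n) ↔ Tiling n
CComp↔Tiling = pellRecurrence⇒↔Tiling CComp1↔⊤ CComp-pellRecurrence

private variable
  m : ℕ
  w : Vec (Fin 3) m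

maximalZeroRun-∷⁻ : ∀ {a i len} → MaximalZeroRun (a ∷ w) (suc i) len → MaximalZeroRun w i len
maximalZeroRun-∷⁻ (len≥1 , zeros , start , end) =
  len≥1 , (λ p i≤p p<i+len → zeros (suc p) (s≤s i≤p) (s≤s p<i+len)) ,
  (λ { k refl → start (suc k) refl }) , end

maximalZeroRun-∷⁺ : ∀ {a i len} → at (a ∷ w) i ≢ just zero₃
                  → MaximalZeroRun w i len → MaximalZeroRun (a ∷ w) (suc i) len
maximalZeroRun-∷⁺ before (len≥1 , zeros , _ , end) =
  len≥1 , (λ { (suc p) (s≤s i≤p) (s≤s p<i+len) → zeros p i≤p p<i+len }) ,
  (λ { k refl → before }) , end

maximalZeroRun-0∷⁻ : ∀ {len} → MaximalZeroRun (zero₃ ∷ w) 0 (suc (suc len))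
                   → MaximalZeroRun w 0 (suc len)
maximalZeroRun-0∷⁻ (_ , zeros , _ , end) =
  s≤s z≤n , (λ p _ p<len → zeros (suc p) z≤n (s≤s p<len)) , (λ _ ()) , end

maximalZeroRun-0∷⁺ : ∀ {len} → MaximalZeroRun w 0 len → MaximalZeroRun (zero₃ ∷ w) 0 (suc len)
maximalZeroRun-0∷⁺ (_ , zeros , _ , end) =
  s≤s z≤n , (λ { zero _ _ → refl ; (suc p) _ (s≤s p<len) → zeros p z≤n p<len }) , (λ _ ()) , end

evenZeroRuns-nonzero∷⁺ : ∀ {b} → EvenZeroRuns w → EvenZeroRuns (fsuc b ∷ w)
evenZeroRuns-nonzero∷⁺ even zero    len (len≥1 , zeros , _) with zeros 0 z≤n len≥1
... | ()
evenZeroRuns-nonzero∷⁺ even (suc i) len run = even i len (maximalZeroRun-∷⁻ run)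

evenZeroRuns-nonzero∷⁻ : ∀ {b} → EvenZeroRuns (fsuc b ∷ w) → EvenZeroRuns w
evenZeroRuns-nonzero∷⁻ {w = w} {b} even i len run@(_ , _ , start , _) =
  even (suc i) len (maximalZeroRun-∷⁺ (before i start) run)
  where
  before : ∀ i → (∀ k → suc k ≡ i → at w k ≢ just zero₃) → at (fsuc b ∷ w) i ≢ just zero₃
  before zero    _     ()
  before (suc i) start = start i refl

evenZeroRuns-00∷⁺ : EvenZeroRuns w → EvenZeroRuns (zero₃ ∷ zero₃ ∷ w)
evenZeroRuns-00∷⁺ even zero (suc zero)    (_ , _ , _ , end) = ⊥-elim (end refl)
evenZeroRuns-00∷⁺ even zero (suc (suc zero)) _            = ∣-refl
evenZeroRuns-00∷⁺ even zero (suc (suc (suc len))) run =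
  ∣m∣n⇒∣m+n ∣-refl (even 0 (suc len) (maximalZeroRun-0∷⁻ (maximalZeroRun-0∷⁻ run)))
evenZeroRuns-00∷⁺ even (suc zero)    len (_ , _ , start , _) = ⊥-elim (start 0 refl refl)
evenZeroRuns-00∷⁺ even (suc (suc i)) len run =
  even i len (maximalZeroRun-∷⁻ (maximalZeroRun-∷⁻ run))

evenZeroRuns-00∷⁻ : EvenZeroRuns (zero₃ ∷ zero₃ ∷ w) → EvenZeroRuns w
evenZeroRuns-00∷⁻ even zero len run =
  ∣m+n∣m⇒∣n (even 0 (2 + len) (maximalZeroRun-0∷⁺ (maximalZeroRun-0∷⁺ run))) ∣-refl
evenZeroRuns-00∷⁻ even (suc i) len run@(_ , _ , start , _) =
  even (3 + i) len (maximalZeroRun-∷⁺ (start i refl) (maximalZeroRun-∷⁺ (start i refl) run))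

¬evenZeroRuns-isolated0∷ : at w 0 ≢ just zero₃ → ¬ EvenZeroRuns (zero₃ ∷ w)
¬evenZeroRuns-isolated0∷ next even
  with ∣1⇒≡1 (even 0 1 (s≤s z≤n , (λ { zero _ _ → refl ; (suc _) _ (s≤s ()) }) , (λ _ ()) , next))
... | ()

word : ∀ {n} → Tiling n → Vec (Fin 3) n
word []       = []
word (1∷ t)   = fsuc fzero ∷ word t
word (2∷ t)   = fsuc (fsuc fzero) ∷ word t
word (00∷ t)  = zero₃ ∷ zero₃ ∷ word t

word-evenZeroRuns : ∀ {n} (t : Tiling n) → EvenZeroRuns (word t)
word-evenZeroRuns []      i len (len≥1 , zeros , _) with zeros i ≤-refl (m<m+n i len≥1)
... | ()
word-evenZeroRuns (1∷ t)  = evenZeroRuns-nonzero∷⁺ (word-evenZeroRuns t)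
word-evenZeroRuns (2∷ t)  = evenZeroRuns-nonzero∷⁺ (word-evenZeroRuns t)
word-evenZeroRuns (00∷ t) = evenZeroRuns-00∷⁺ (word-evenZeroRuns t)

word-injective : ∀ {n} (s t : Tiling n) → word s ≡ word t → s ≡ t
word-injective []      []      _  = refl
word-injective (1∷ s)  (1∷ t)  eq = cong 1∷_ (word-injective s t (∷-injectiveʳ eq))
word-injective (2∷ s)  (2∷ t)  eq = cong 2∷_ (word-injective s t (∷-injectiveʳ eq))
word-injective (00∷ s) (00∷ t) eq = cong 00∷_ (word-injective s t (∷-injectiveʳ (∷-injectiveʳ eq)))
word-injective (1∷ s)  (2∷ t)  ()
word-injective (1∷ s)  (00∷ t) ()
word-injective (2∷ s)  (1∷ t)  ()
word-injective (2∷ s)  (00∷ t) ()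
word-injective (00∷ s) (1∷ t)  ()
word-injective (00∷ s) (2∷ t)  ()

word-surjective : ∀ {n} (v : Vec (Fin 3) n) → EvenZeroRuns v → Σ (Tiling n) (λ t → word t ≡ v)
word-surjective [] _ = [] , refl
word-surjective (fsuc fzero ∷ v) even with word-surjective v (evenZeroRuns-nonzero∷⁻ even)
... | t , refl = 1∷ t , refl
word-surjective (fsuc (fsuc fzero) ∷ v) even with word-surjective v (evenZeroRuns-nonzero∷⁻ even)
... | t , refl = 2∷ t , refl
word-surjective (fzero ∷ fzero ∷ v) even with word-surjective v (evenZeroRuns-00∷⁻ even)
... | t , refl = 00∷ t , refl
word-surjective (fzero ∷ [])         even = ⊥-elim (¬evenZeroRuns-isolated0∷ (λ ()) even)
word-surjective (fzero ∷ fsuc _ ∷ v) even = ⊥-elim (¬evenZeroRuns-isolated0∷ (λ ()) even)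

word-bijOnto : ∀ {n} → BijOntoEvenZeroRunWords n (word {n})
word-bijOnto = word-injective _ _ , word-evenZeroRuns , word-surjective

bijOnto-∘↔ : ∀ {A B : Set} {n} {f : B → Vec (Fin 3) n} (e : A ↔ B)
           → BijOntoEvenZeroRunWords n f → BijOntoEvenZeroRunWords n (f ∘ Inverse.to e)
bijOnto-∘↔ {f = f} e (f-injective , f-even , f-onto) =
  Injection.injective (↔⇒↣ e) ∘ f-injective , f-even ∘ to , onto
  where
  open Inverse e using (to; from; strictlyInverseˡ)
  onto : ∀ v → EvenZeroRuns v → Σ _ (λ a → f (to a) ≡ v)
  onto v even with f-onto v even
  ... | b , refl = from b , cong f (strictlyInverseˡ b)

theorem3p2 : (n : ℕ) → 1 ≤ n →
    Σ (CComp n → Vec (Fin 3) (n ∸ 1)) (BijOntoEvenZeroRunWords (n ∸ 1))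
    × (CComp n ↔ Fin (pell n))
theorem3p2 (suc n) _ =
  (word ∘ Inverse.to (CComp↔Tiling n) , bijOnto-∘↔ (CComp↔Tiling n) word-bijOnto) ,
  ↔-trans (CComp↔Tiling n) (↔-sym (Fin-pell↔Tiling n))
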